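{- Let $G$ be a connected simple graph with vertices $v_1,\dots,v_n$ and let $B_G=(L_G+I_n)^{ -1}=[b_{ij}]$. Let $v_i$ be a vertex and $v_j$ a vertex different from $v_i$. Then there exists a $v_jv_i$-path $v_j,v_{j_1},v_{j_2},\dots,v_{j_k},v_i$ in $G$ such that \[ b_{ij}<b_{i,j_1}<\cdots<b_{i,j_k}<b_{ii}. \] In particular $b_{ii}>b_{ij}$, so each diagonal entry of $B_G$ is strictly the largest entry in its row and in its column.
   Context: $L_G=D-A$ is the Laplacian matrix of $G$ ($A$ adjacency matrix, $D$ diagonal matrix of degrees), with row/column $i$ corresponding to vertex $v_i$; $L_G+I_n$ is positive definite, hence invertible, and $B_G$ is symmetric. -}

module Defs where

open import Data.Nat using (ℕ; zero; suc)
open import Data.Fin using (Fin; zero; suc; _≟_)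
open import Data.Bool using (Bool; true; false; if_then_else_; T)
open import Data.Rational using (ℚ; 0ℚ; 1ℚ; _+_; _-_; _*_)
open import Data.List using (List; []; _∷_; _++_)
open import Data.List.Relation.Unary.Linked using (Linked)
open import Data.Product using (∃)
open import Relation.Nullary using (¬_)
open import Relation.Nullary.Decidable using (⌊_⌋)
open import Relation.Binary.PropositionalEquality using (_≡_)

record SimpleGraph (n : ℕ) : Set where
  field
    adj    : Fin n → Fin n → Bool
    sym    : ∀ i j → adj i j ≡ adj j i
    irrefl : ∀ i → adj i i ≡ false

open SimpleGraph public

Adj : ∀ {n} → SimpleGraph n → Fin n → Fin n → Set
Adj G i j = T (adj G i j)

Connected : ∀ {n} → SimpleGraph n → Set
Connected {n} G = ∀ (u v : Fin n) → ¬ (u ≡ v) →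
  ∃ λ (ks : List (Fin n)) → Linked (Adj G) (u ∷ ks ++ (v ∷ []))

Matrix : ℕ → Set
Matrix n = Fin n → Fin n → ℚ

∑ : ∀ {n} → (Fin n → ℚ) → ℚ
∑ {zero}  f = 0ℚ
∑ {suc n} f = f zero + ∑ (λ i → f (suc i))

_⊗_ : ∀ {n} → Matrix n → Matrix n → Matrix n
(M ⊗ N) i j = ∑ (λ k → M i k * N k j)

identity : ∀ {n} → Matrix n
identity i j = if ⌊ i ≟ j ⌋ then 1ℚ else 0ℚ

adjacencyMatrix : ∀ {n} → SimpleGraph n → Matrix n
adjacencyMatrix G i j = if adj G i j then 1ℚ else 0ℚ

degree : ∀ {n} → SimpleGraph n → Fin n → ℚ
degree G i = ∑ (adjacencyMatrix G i)

degreeMatrix : ∀ {n} → SimpleGraph n → Matrix n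
degreeMatrix G i j = if ⌊ i ≟ j ⌋ then degree G i else 0ℚ

laplacian : ∀ {n} → SimpleGraph n → Matrix n
laplacian G i j = degreeMatrix G i j - adjacencyMatrix G i j

laplacianPlusId : ∀ {n} → SimpleGraph n → Matrix n
laplacianPlusId G i j = laplacian G i j + identity i j

IsInverseOf : ∀ {n} → Matrix n → Matrix n → Set
IsInverseOf B M = (∀ i j → (M ⊗ B) i j ≡ identity i j) × (∀ i j → (B ⊗ M) i j ≡ identity i j)
  where open import Data.Product using (_×_)

{-# OPTIONS --safe #-}
-- A row y of B = (L_G + I)⁻¹ solves (L_G + I) y = e_i, that is
-- y j = δ_ij + Σ_{k ~ j} (y k − y j).  At a global minimum of y the sum is
-- nonnegative, so y ≥ 0; where y vanishes all neighbours vanish too, so y > 0 on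
-- the connected graph.  Hence every j ≠ i has a neighbour with strictly larger
-- value (otherwise y j ≤ 0), and climbing along such neighbours, which must stop
-- since Fin n is finite, ends at i.  Columns behave the same because L_G + I is
-- symmetric.
module Submission where

open import Defs hiding (sym)
open import Data.Nat using (ℕ; zero; suc)
open import Data.Fin using (Fin; zero; suc; _≟_)
open import Data.Fin.Properties using (any?)
open import Data.Fin.Induction using (spo-noetherian)
open import Data.Bool using (true; false; if_then_else_; T)
open import Data.Unit using (tt)
open import Data.Empty using (⊥-elim)
open import Data.Product using (∃; _×_; _,_; proj₁; proj₂)
open import Data.List using (List; []; _∷_; _++_; [_]; allFin)
open import Data.List.Relation.Unary.All as All using (_∷_)
import Data.List.Relation.Unary.All.Properties as All
open import Data.List.Relation.Unary.AllPairs as AllPairs using (_∷_)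
open import Data.List.Relation.Unary.Linked using (Linked; [-]; _∷_)
open import Data.List.Relation.Unary.Linked.Properties using (Linked⇒AllPairs)
open import Data.List.Relation.Unary.Unique.Propositional using (Unique)
open import Data.List.Membership.Propositional.Properties using (∈-allFin)
open import Data.Rational using (ℚ; 0ℚ; 1ℚ; _+_; _-_; _*_; -_; _≤_; _<_; _<?_)
open import Data.Rational.Properties as ℚ
  using ( ≤-refl; ≤-antisym; ≮⇒≥; <-irrefl; <-≤-trans; ≤-trans
        ; +-mono-≤; +-monoˡ-≤; +-monoʳ-≤; +-identityˡ; +-identityʳ; +-inverseʳ
        ; *-comm; ≤-decTotalOrder; <-isStrictPartialOrder; +-0-group)
open import Data.Rational.Solver using (module +-*-Solver)
open import Algebra.Properties.Group +-0-group using (x∙y⁻¹≈ε⇒x≈y)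
open import Function using (_∘_; _on_; flip)
open import Induction.WellFounded using (Acc; acc)
open import Relation.Binary using (Rel; Transitive; Irreflexive; IsStrictPartialOrder; DecTotalOrder)
open import Data.List.Extrema (DecTotalOrder.totalOrder ≤-decTotalOrder) using (argmin; f[argmin]≤f[xs])
import Relation.Binary.Construct.On as On
open import Relation.Nullary using (¬_; yes; no)
open import Relation.Nullary.Decidable using (⌊_⌋; ⌊⌋-map′; T?; _×-dec_)
open import Relation.Binary.PropositionalEquality
  using (_≡_; _≢_; refl; sym; trans; cong; cong₂; subst; subst₂; module ≡-Reasoning)

open +-*-Solver using (solve; _:=_; _:+_; _:*_; _:-_; con)

private
  variable
    n : ℕ

module _ {a r} {A : Set a} {R : Rel A r} (R-trans : Transitive R) where

  Linked-head-last : ∀ {x z} xs → Linked R (x ∷ xs ++ [ z ]) → R x z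
  Linked-head-last xs linked with Linked⇒AllPairs R-trans linked
  ... | Rx∷xs ∷ _ with All.++⁻ʳ xs Rx∷xs
  ...   | Rxz ∷ _ = Rxz

  Linked⇒Unique : Irreflexive _≡_ R → ∀ {xs} → Linked R xs → Unique xs
  Linked⇒Unique R-irrefl linked =
    AllPairs.map (λ Rxy x≡y → R-irrefl x≡y Rxy) (Linked⇒AllPairs R-trans linked)

module _ {ℓ r e} {_≈_ : Rel (Fin n) ℓ} {_⊏_ : Rel (Fin n) r} {E : Rel (Fin n) e}
         (⊏-isSPO : IsStrictPartialOrder _≈_ _⊏_) (i : Fin n) where

  climb : (∀ j → j ≢ i → ∃ λ k → E j k × j ⊏ k) →
          ∀ j → j ≢ i → ∃ λ ks → Linked E (j ∷ ks ++ [ i ]) × Linked _⊏_ (j ∷ ks ++ [ i ])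
  climb step j = go j (spo-noetherian ⊏-isSPO j)
    where
    go : ∀ j → Acc (flip _⊏_) j → j ≢ i →
         ∃ λ ks → Linked E (j ∷ ks ++ [ i ]) × Linked _⊏_ (j ∷ ks ++ [ i ])
    go j (acc higher) j≢i with step j j≢i
    ... | k , jEk , j⊏k with k ≟ i
    ...   | yes refl = [] , jEk ∷ [-] , j⊏k ∷ [-]
    ...   | no k≢i with go k (higher j⊏k) k≢i
    ...     | ks , E-walk , ⊏-walk = k ∷ ks , jEk ∷ E-walk , j⊏k ∷ ⊏-walk

p≤q⇒0≤q-p : ∀ {p q} → p ≤ q → 0ℚ ≤ q - p
p≤q⇒0≤q-p {p} {q} p≤q = subst (_≤ q - p) (+-inverseʳ p) (+-monoˡ-≤ (- p) p≤q)

p≤q⇒p-q≤0 : ∀ {p q} → p ≤ q → p - q ≤ 0ℚ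
p≤q⇒p-q≤0 {p} {q} p≤q = subst (p - q ≤_) (+-inverseʳ q) (+-monoˡ-≤ (- q) p≤q)

nonNeg+nonNeg≡0 : ∀ {p q} → 0ℚ ≤ p → 0ℚ ≤ q → p + q ≡ 0ℚ → p ≡ 0ℚ × q ≡ 0ℚ
nonNeg+nonNeg≡0 {p} {q} 0≤p 0≤q p+q≡0 = ≤-antisym p≤0 0≤p , ≤-antisym q≤0 0≤q
  where
  p≤0 : p ≤ 0ℚ
  p≤0 = subst₂ _≤_ (+-identityʳ p) p+q≡0 (+-monoʳ-≤ p 0≤q)
  q≤0 : q ≤ 0ℚ
  q≤0 = subst₂ _≤_ (+-identityˡ q) p+q≡0 (+-monoˡ-≤ q 0≤p)

∑-cong : {f g : Fin n → ℚ} → (∀ k → f k ≡ g k) → ∑ f ≡ ∑ g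
∑-cong {zero}  f≗g = refl
∑-cong {suc n} f≗g = cong₂ _+_ (f≗g zero) (∑-cong (f≗g ∘ suc))

∑-zero : ∑ {n} (λ _ → 0ℚ) ≡ 0ℚ
∑-zero {zero}  = refl
∑-zero {suc n} = trans (+-identityˡ _) (∑-zero {n})

∑-distrib-+ : (f g : Fin n → ℚ) → ∑ (λ k → f k + g k) ≡ ∑ f + ∑ g
∑-distrib-+ {zero}  f g = refl
∑-distrib-+ {suc n} f g = begin
  (f zero + g zero) + ∑ (λ k → f (suc k) + g (suc k))
    ≡⟨ cong (f zero + g zero +_) (∑-distrib-+ (f ∘ suc) (g ∘ suc)) ⟩
  (f zero + g zero) + (∑ (f ∘ suc) + ∑ (g ∘ suc))
    ≡⟨ solve 4 (λ a b c d → (a :+ b) :+ (c :+ d) := (a :+ c) :+ (b :+ d)) refl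
         (f zero) (g zero) (∑ (f ∘ suc)) (∑ (g ∘ suc)) ⟩
  (f zero + ∑ (f ∘ suc)) + (g zero + ∑ (g ∘ suc)) ∎
  where open ≡-Reasoning

∑-*ʳ : (f : Fin n → ℚ) (c : ℚ) → ∑ (λ k → f k * c) ≡ ∑ f * c
∑-*ʳ {zero}  f c = sym (ℚ.*-zeroˡ c)
∑-*ʳ {suc n} f c =
  trans (cong (f zero * c +_) (∑-*ʳ (f ∘ suc) c)) (sym (ℚ.*-distribʳ-+ c (f zero) _))

∑-δ : (j : Fin n) (c : ℚ) → ∑ (λ k → if ⌊ j ≟ k ⌋ then c else 0ℚ) ≡ c
∑-δ {suc n} zero    c = trans (cong (c +_) (∑-zero {n})) (+-identityʳ c)
∑-δ {suc n} (suc j) c = begin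
  0ℚ + ∑ (λ k → if ⌊ suc j ≟ suc k ⌋ then c else 0ℚ)
    ≡⟨ +-identityˡ _ ⟩
  ∑ (λ k → if ⌊ suc j ≟ suc k ⌋ then c else 0ℚ)
    ≡⟨ ∑-cong (λ k → cong (if_then c else 0ℚ) (⌊⌋-map′ _ _ (j ≟ k))) ⟩
  ∑ (λ k → if ⌊ j ≟ k ⌋ then c else 0ℚ)
    ≡⟨ ∑-δ j c ⟩
  c ∎
  where open ≡-Reasoning

∑-mono-≤ : {f g : Fin n → ℚ} → (∀ k → f k ≤ g k) → ∑ f ≤ ∑ g
∑-mono-≤ {zero}  f≤g = ≤-refl
∑-mono-≤ {suc n} f≤g = +-mono-≤ (f≤g zero) (∑-mono-≤ (f≤g ∘ suc))

∑-nonNeg : {f : Fin n → ℚ} → (∀ k → 0ℚ ≤ f k) → 0ℚ ≤ ∑ f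
∑-nonNeg {n} {f} 0≤f = subst (_≤ ∑ f) (∑-zero {n}) (∑-mono-≤ 0≤f)

∑-nonPos : {f : Fin n → ℚ} → (∀ k → f k ≤ 0ℚ) → ∑ f ≤ 0ℚ
∑-nonPos {n} {f} f≤0 = subst (∑ f ≤_) (∑-zero {n}) (∑-mono-≤ f≤0)

∑-nonNeg≡0 : {f : Fin n → ℚ} → (∀ k → 0ℚ ≤ f k) → ∑ f ≡ 0ℚ → ∀ k → f k ≡ 0ℚ
∑-nonNeg≡0 {suc n} 0≤f ∑f≡0 k with nonNeg+nonNeg≡0 (0≤f zero) (∑-nonNeg (0≤f ∘ suc)) ∑f≡0
∑-nonNeg≡0 {suc n} 0≤f ∑f≡0 zero    | f₀≡0 , _    = f₀≡0
∑-nonNeg≡0 {suc n} 0≤f ∑f≡0 (suc k) | _    , rest = ∑-nonNeg≡0 (0≤f ∘ suc) rest k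

_*ᵥ_ : Matrix n → (Fin n → ℚ) → Fin n → ℚ
(M *ᵥ y) j = ∑ λ k → M j k * y k

neighbourGap : SimpleGraph n → (Fin n → ℚ) → Fin n → Fin n → ℚ
neighbourGap G y j k = if adj G j k then y k - y j else 0ℚ

Δ : SimpleGraph n → (Fin n → ℚ) → Fin n → ℚ
Δ G y j = ∑ (neighbourGap G y j)

adjacencyMatrix-sym : (G : SimpleGraph n) (j k : Fin n) →
                      adjacencyMatrix G j k ≡ adjacencyMatrix G k j
adjacencyMatrix-sym G j k = cong (if_then 1ℚ else 0ℚ) (SimpleGraph.sym G j k)

laplacianPlusId-sym : (G : SimpleGraph n) (j k : Fin n) →
                      laplacianPlusId G j k ≡ laplacianPlusId G k j
laplacianPlusId-sym G j k with j ≟ k | k ≟ j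
... | yes refl | yes _   = refl
... | no _     | no _    = cong (λ a → (0ℚ - a) + 0ℚ) (adjacencyMatrix-sym G j k)
... | yes j≡k  | no k≢j  = ⊥-elim (k≢j (sym j≡k))
... | no j≢k   | yes k≡j = ⊥-elim (j≢k (sym k≡j))

-- The term A_jk * y j is added on the left so that summing over k needs only
-- additivity of ∑ and no subtraction of sums.
laplacianPlusId-entry : (G : SimpleGraph n) (y : Fin n → ℚ) (j k : Fin n) →
  laplacianPlusId G j k * y k + (neighbourGap G y j k + adjacencyMatrix G j k * y j)
    ≡ (if ⌊ j ≟ k ⌋ then (degree G j + 1ℚ) * y j else 0ℚ)
laplacianPlusId-entry G y j k with j ≟ k
... | yes refl rewrite irrefl G j =
  solve 2 (λ d a → ((d :- con 0ℚ) :+ con 1ℚ) :* a :+ (con 0ℚ :+ con 0ℚ :* a) := (d :+ con 1ℚ) :* a)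
        refl (degree G j) (y j)
... | no _ with adj G j k
...   | true  = solve 2 (λ b a → ((con 0ℚ :- con 1ℚ) :+ con 0ℚ) :* b :+ ((b :- a) :+ con 1ℚ :* a) := con 0ℚ)
                      refl (y k) (y j)
...   | false = solve 2 (λ b a → ((con 0ℚ :- con 0ℚ) :+ con 0ℚ) :* b :+ (con 0ℚ :+ con 0ℚ :* a) := con 0ℚ)
                      refl (y k) (y j)

laplacianPlusId-*ᵥ : (G : SimpleGraph n) (y : Fin n → ℚ) (j : Fin n) →
                     (laplacianPlusId G *ᵥ y) j + Δ G y j ≡ y j
laplacianPlusId-*ᵥ G y j = begin
  (M *ᵥ y) j + Δ G y j
    ≡⟨ solve 3 (λ a b c → a :+ b := (a :+ (b :+ c)) :- c) refl ((M *ᵥ y) j) (Δ G y j) (d * y j) ⟩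
  ((M *ᵥ y) j + (Δ G y j + d * y j)) - d * y j
    ≡⟨ cong (_- d * y j) rowSum ⟩
  (d + 1ℚ) * y j - d * y j
    ≡⟨ solve 2 (λ d a → (d :+ con 1ℚ) :* a :- d :* a := a) refl d (y j) ⟩
  y j ∎
  where
  open ≡-Reasoning
  M = laplacianPlusId G
  d = degree G j
  rowSum : (M *ᵥ y) j + (Δ G y j + d * y j) ≡ (d + 1ℚ) * y j
  rowSum = begin
    (M *ᵥ y) j + (Δ G y j + d * y j)
      ≡⟨ cong (λ t → (M *ᵥ y) j + (Δ G y j + t)) (sym (∑-*ʳ (adjacencyMatrix G j) (y j))) ⟩
    (M *ᵥ y) j + (Δ G y j + ∑ (λ k → adjacencyMatrix G j k * y j))
      ≡⟨ cong ((M *ᵥ y) j +_) (sym (∑-distrib-+ (neighbourGap G y j) (λ k → adjacencyMatrix G j k * y j))) ⟩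
    (M *ᵥ y) j + ∑ (λ k → neighbourGap G y j k + adjacencyMatrix G j k * y j)
      ≡⟨ sym (∑-distrib-+ (λ k → M j k * y k) _) ⟩
    ∑ (λ k → M j k * y k + (neighbourGap G y j k + adjacencyMatrix G j k * y j))
      ≡⟨ ∑-cong (laplacianPlusId-entry G y j) ⟩
    ∑ (λ k → if ⌊ j ≟ k ⌋ then (d + 1ℚ) * y j else 0ℚ)
      ≡⟨ ∑-δ j _ ⟩
    (d + 1ℚ) * y j ∎

neighbourGap-adj : (G : SimpleGraph n) (y : Fin n → ℚ) {j k : Fin n} →
                   Adj G j k → neighbourGap G y j k ≡ y k - y j
neighbourGap-adj G y {j} {k} j~k with adj G j k
... | true = refl

module ScreenedPoisson {n} (G : SimpleGraph n) (s : Fin n → ℚ) (s≥0 : ∀ j → 0ℚ ≤ s j)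
                       (y : Fin n → ℚ) (solves : ∀ j → (laplacianPlusId G *ᵥ y) j ≡ s j) where

  balance : ∀ j → y j ≡ s j + Δ G y j
  balance j = trans (sym (laplacianPlusId-*ᵥ G y j)) (cong (_+ Δ G y j) (solves j))

  nonNeg : ∀ a → 0ℚ ≤ y a
  nonNeg a = ≤-trans 0≤yₘ (lowest a)
    where
    m = argmin y a (allFin n)
    lowest : ∀ k → y m ≤ y k
    lowest k = All.lookup (f[argmin]≤f[xs] {f = y} a (allFin n)) (∈-allFin k)
    gap≥0 : ∀ k → 0ℚ ≤ neighbourGap G y m k
    gap≥0 k with adj G m k
    ... | true  = p≤q⇒0≤q-p (lowest k)
    ... | false = ≤-refl
    0≤yₘ : 0ℚ ≤ y m
    0≤yₘ = begin
      0ℚ            ≤⟨ +-mono-≤ (s≥0 m) (∑-nonNeg gap≥0) ⟩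
      s m + Δ G y m ≡⟨ sym (balance m) ⟩
      y m           ∎
      where open ℚ.≤-Reasoning

  zero-spreads : ∀ j → y j ≡ 0ℚ → s j ≡ 0ℚ × (∀ k → Adj G j k → y k ≡ 0ℚ)
  zero-spreads j yⱼ≡0 = proj₁ split , neighbour≡0
    where
    gap≥0 : ∀ k → 0ℚ ≤ neighbourGap G y j k
    gap≥0 k with adj G j k
    ... | true  = p≤q⇒0≤q-p (subst (_≤ y k) (sym yⱼ≡0) (nonNeg k))
    ... | false = ≤-refl
    split : s j ≡ 0ℚ × Δ G y j ≡ 0ℚ
    split = nonNeg+nonNeg≡0 (s≥0 j) (∑-nonNeg gap≥0) (trans (sym (balance j)) yⱼ≡0)
    neighbour≡0 : ∀ k → Adj G j k → y k ≡ 0ℚ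
    neighbour≡0 k j~k = trans (x∙y⁻¹≈ε⇒x≈y (y k) (y j) gap≡0) yⱼ≡0
      where
      gap≡0 : y k - y j ≡ 0ℚ
      gap≡0 = trans (sym (neighbourGap-adj G y j~k)) (∑-nonNeg≡0 gap≥0 (proj₂ split) k)

  zero-propagates : ∀ {x z} ks → Linked (Adj G) (x ∷ ks ++ [ z ]) → y x ≡ 0ℚ → y z ≡ 0ℚ
  zero-propagates []       (x~z ∷ [-])  yₓ≡0 = proj₂ (zero-spreads _ yₓ≡0) _ x~z
  zero-propagates (k ∷ ks) (x~k ∷ walk) yₓ≡0 =
    zero-propagates ks walk (proj₂ (zero-spreads _ yₓ≡0) k x~k)

  positive : Connected G → ∀ i → 0ℚ < s i → ∀ a → 0ℚ < y a
  positive conn i 0<sᵢ a with 0ℚ <? y a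
  ... | yes 0<yₐ = 0<yₐ
  ... | no  0≮yₐ = ⊥-elim (<-irrefl (sym (proj₁ (zero-spreads i yᵢ≡0))) 0<sᵢ)
    where
    yₐ≡0 : y a ≡ 0ℚ
    yₐ≡0 = ≤-antisym (≮⇒≥ 0≮yₐ) (nonNeg a)
    yᵢ≡0 : y i ≡ 0ℚ
    yᵢ≡0 with a ≟ i
    ... | yes a≡i = subst (λ b → y b ≡ 0ℚ) a≡i yₐ≡0
    ... | no  a≢i = zero-propagates (proj₁ (conn a i a≢i)) (proj₂ (conn a i a≢i)) yₐ≡0

  ascent : Connected G → ∀ i → 0ℚ < s i → ∀ j → s j ≡ 0ℚ → ∃ λ k → Adj G j k × y j < y k
  ascent conn i 0<sᵢ j sⱼ≡0 with any? (λ k → T? (adj G j k) ×-dec (y j <? y k))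
  ... | yes higher = higher
  ... | no  none   = ⊥-elim (<-irrefl refl (<-≤-trans (positive conn i 0<sᵢ j) yⱼ≤0))
    where
    gap≤0 : ∀ k → neighbourGap G y j k ≤ 0ℚ
    gap≤0 k with adj G j k in j~k
    ... | true  = p≤q⇒p-q≤0 (≮⇒≥ (λ yⱼ<yₖ → none (k , subst T (sym j~k) tt , yⱼ<yₖ)))
    ... | false = ≤-refl
    yⱼ≤0 : y j ≤ 0ℚ
    yⱼ≤0 = begin
      y j           ≡⟨ balance j ⟩
      s j + Δ G y j ≡⟨ cong (_+ Δ G y j) sⱼ≡0 ⟩
      0ℚ + Δ G y j  ≡⟨ +-identityˡ (Δ G y j) ⟩
      Δ G y j       ≤⟨ ∑-nonPos gap≤0 ⟩
      0ℚ            ∎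
      where open ℚ.≤-Reasoning

identity-nonNeg : (i j : Fin n) → 0ℚ ≤ identity i j
identity-nonNeg i j with i ≟ j
... | yes _ = ℚ.nonNegative⁻¹ 1ℚ
... | no  _ = ≤-refl

identity-diag>0 : (i : Fin n) → 0ℚ < identity i i
identity-diag>0 i with i ≟ i
... | yes _   = ℚ.positive⁻¹ 1ℚ
... | no  i≢i = ⊥-elim (i≢i refl)

identity-offdiag : {i j : Fin n} → i ≢ j → identity i j ≡ 0ℚ
identity-offdiag {i = i} {j} i≢j with i ≟ j
... | yes i≡j = ⊥-elim (i≢j i≡j)
... | no  _   = refl

identity-sym : (i j : Fin n) → identity i j ≡ identity j i
identity-sym i j with i ≟ j | j ≟ i
... | yes _   | yes _   = refl
... | no  _   | no  _   = refl
... | yes i≡j | no  j≢i = ⊥-elim (j≢i (sym i≡j))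
... | no  i≢j | yes j≡i = ⊥-elim (i≢j (sym j≡i))

row-solves : (G : SimpleGraph n) {B : Matrix n} → IsInverseOf B (laplacianPlusId G) →
             ∀ i j → (laplacianPlusId G *ᵥ B i) j ≡ identity i j
row-solves G {B} (_ , B⊗M≡I) i j =
  trans (∑-cong (λ k → trans (*-comm (laplacianPlusId G j k) (B i k))
                              (cong (B i k *_) (laplacianPlusId-sym G j k))))
        (B⊗M≡I i j)

column-solves : (G : SimpleGraph n) {B : Matrix n} → IsInverseOf B (laplacianPlusId G) →
                ∀ i j → (laplacianPlusId G *ᵥ (λ a → B a i)) j ≡ identity i j
column-solves G (M⊗B≡I , _) i j = trans (M⊗B≡I j i) (identity-sym j i)

ascending-walk : (G : SimpleGraph n) → Connected G → (i : Fin n) (y : Fin n → ℚ) →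
  (∀ j → (laplacianPlusId G *ᵥ y) j ≡ identity i j) →
  ∀ j → j ≢ i → ∃ λ ks → Linked (Adj G) (j ∷ ks ++ [ i ]) × Linked (_<_ on y) (j ∷ ks ++ [ i ])
ascending-walk G conn i y solves =
  climb (On.isStrictPartialOrder y <-isStrictPartialOrder) i
        (λ j j≢i → ascent conn i (identity-diag>0 i) j (identity-offdiag (j≢i ∘ sym)))
  where open ScreenedPoisson G (identity i) (identity-nonNeg i) y solves

theorem3p6 : ∀ {n : ℕ} (G : SimpleGraph n) → Connected G →
    (B : Matrix n) → IsInverseOf B (laplacianPlusId G) →
    (i j : Fin n) → ¬ (j ≡ i) →
    (∃ λ (ks : List (Fin n)) →
        Linked (Adj G) (j ∷ ks ++ (i ∷ []))
      × Unique (j ∷ ks ++ (i ∷ []))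
      × Linked (λ a b → B i a < B i b) (j ∷ ks ++ (i ∷ [])))
    × (B i j < B i i) × (B j i < B i i)
theorem3p6 G conn B inv i j j≢i
  with ascending-walk G conn i (B i) (row-solves G inv i) j j≢i
     | ascending-walk G conn i (λ a → B a i) (column-solves G inv i) j j≢i
... | ks , walk , row↑ | ks′ , _ , column↑ =
  (ks , walk , Linked⇒Unique ℚ.<-trans (λ a≡b → <-irrefl (cong (B i) a≡b)) row↑ , row↑) ,
  Linked-head-last ℚ.<-trans ks row↑ ,
  Linked-head-last ℚ.<-trans ks′ column↑
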